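{- Let $\mathbb{K}$ be a field of characteristic $0$ and $\mathcal{H}$ the $\mathbb{K}$-vector space freely spanned by totally assigned graphs (TAGs). Define $\Delta:\mathcal{H}\to\mathcal{H}\otimes\mathcal{H}$ linearly by $$\Delta\big((\Gamma,\mu)\big)=\sum_{\emptyset\subseteq(\gamma,\nu)\subseteq(\Gamma,\mu)}(\gamma,\nu)\otimes(\Gamma/\gamma,\mu/\nu),$$ the sum running over all totally assigned subgraphs of $(\Gamma,\mu)$ (including the empty one and $(\Gamma,\mu)$ itself). Then $\Delta$ is coassociative: $(\Delta\otimes\mathrm{Id})\circ\Delta=(\mathrm{Id}\otimes\Delta)\circ\Delta$.
   Context: Graphs are finite, possibly disconnected, with loops and multiple edges allowed; $E(\Gamma)$ is the edge set. A TAG is a pair $(\Gamma,\mu)$ where $\mu$ is a total order on $E(\Gamma)$; the empty graph is denoted $1_{\mathcal{H}}$. A subgraph $\gamma$ of $\Gamma$ is the graph formed by a subset of $E(\Gamma)$ together with the vertices these edges are incident to in $\Gamma$. A totally assigned subgraph $(\gamma,\nu)$ of $(\Gamma,\mu)$ is a subgraph with $\nu$ the restriction of $\mu$ to $E(\gamma)$. The shrinking $(\Gamma/\gamma,\mu/\nu)$: $\Gamma/\gamma$ is obtained by contracting each connected component of $\gamma$ to a point, and $\mu/\nu$ is the restriction of $\mu$ to the edges of $\Gamma$ not in $\gamma$. -}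

module Defs where

open import Level using (Level; _⊔_)
open import Data.Nat using (ℕ; zero; suc)
open import Data.Fin using (Fin; _≟_)
open import Data.Product using (_×_; _,_; Σ; proj₁; proj₂)
open import Data.Sum using (_⊎_)
open import Data.List using (List; []; _∷_; map; concatMap; foldl)
open import Data.List.Relation.Unary.Any using (Any)
open import Data.List.Relation.Binary.Pointwise using (Pointwise)
open import Relation.Nullary using (¬_; yes; no)
open import Relation.Binary.PropositionalEquality using (_≡_)
open import Algebra.Bundles using (CommutativeRing)

-- A TAG on vertex set Fin m is the list of its edges; each edge is given
-- by its (unordered) pair of endpoints.  Loops (u , u) and repeated
-- edges are allowed.  The total order μ on the edges is the list order.

record TAG : Set where
  constructor tag
  field
    nV    : ℕ
    edges : List (Fin nV × Fin nV)
open TAG public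

1H : TAG
1H = tag 0 []

Incident : ∀ {m} → List (Fin m × Fin m) → Fin m → Set
Incident es v = Any (λ e → v ≡ proj₁ e ⊎ v ≡ proj₂ e) es

MapsEdge : ∀ {m m'} → (Fin m → Fin m') → Fin m × Fin m → Fin m' × Fin m' → Set
MapsEdge f (a , b) (a' , b') = (f a ≡ a' × f b ≡ b') ⊎ (f a ≡ b' × f b ≡ a')

-- Isomorphism of TAGs: a map on vertices, injective on the (non-isolated)
-- vertices, carrying the i-th edge to the i-th edge for every i (i.e. the
-- edge bijection preserves the total orders).  Vertices not incident to
-- any edge are irrelevant (a graph is the graph spanned by its edges).
_≅_ : TAG → TAG → Set
tag m es ≅ tag m' es' =
  Σ (Fin m → Fin m') λ f →
    Pointwise (MapsEdge f) es es' ×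
    (∀ u v → Incident es u → Incident es v → f u ≡ f v → u ≡ v)

-- all ways of choosing a subset of the edges: (chosen , not chosen),
-- both in the induced order
splits : {A : Set} → List A → List (List A × List A)
splits []       = ([] , []) ∷ []
splits (x ∷ xs) =
  concatMap (λ p → (x ∷ proj₁ p , proj₂ p) ∷ (proj₁ p , x ∷ proj₂ p) ∷ [])
            (splits xs)

-- labelling of vertices by connected components: after processing the
-- edges of γ, c u ≡ c v iff u and v lie in the same component of γ
-- (isolated vertices of γ are their own component).
mergeEdge : ∀ {m} → (Fin m → Fin m) → Fin m × Fin m → Fin m → Fin m
mergeEdge c (u , v) w with c w ≟ c v
... | yes _ = c u
... | no  _ = c w

component : ∀ {m} → List (Fin m × Fin m) → Fin m → Fin m
component {m} γ = foldl mergeEdge (λ w → w) γ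

-- (Γ/γ, μ/ν): contract each component of γ to a point, keep the remaining
-- edges in their order
shrink : ∀ {m} → List (Fin m × Fin m) → List (Fin m × Fin m) → TAG
shrink {m} γ rest =
  tag m (map (λ e → (component γ (proj₁ e) , component γ (proj₂ e))) rest)

subgraphPairs : TAG → List (TAG × TAG)
subgraphPairs (tag m es) =
  map (λ p → (tag m (proj₁ p) , shrink (proj₁ p) (proj₂ p))) (splits es)

module FieldDefs {c ℓ} (K : CommutativeRing c ℓ) where
  open CommutativeRing K

  IsField : Set (c ⊔ ℓ)
  IsField = (¬ (1# ≈ 0#)) ×
            (∀ x → ¬ (x ≈ 0#) → Σ Carrier λ y → (x * y) ≈ 1#)

  natK : ℕ → Carrier
  natK zero    = 0#
  natK (suc n) = 1# + natK n

  CharZero : Set ℓ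
  CharZero = ∀ n → ¬ (natK (suc n) ≈ 0#)

module Hopf {c ℓ} (K : CommutativeRing c ℓ) where
  open CommutativeRing K

  Formal : Set → Set c
  Formal B = List (Carrier × B)

  -- equality in the free K-vector space on B / ~ :
  -- congruence generated by the defining relations of formal sums
  data FreeEq {B : Set} (_~_ : B → B → Set) : Formal B → Formal B → Set (c ⊔ ℓ) where
    fe-refl  : ∀ {x} → FreeEq _~_ x x
    fe-sym   : ∀ {x y} → FreeEq _~_ x y → FreeEq _~_ y x
    fe-trans : ∀ {x y z} → FreeEq _~_ x y → FreeEq _~_ y z → FreeEq _~_ x z
    fe-cons  : ∀ {a x y} → FreeEq _~_ x y → FreeEq _~_ (a ∷ x) (a ∷ y)
    fe-swap  : ∀ {a b x} → FreeEq _~_ (a ∷ b ∷ x) (b ∷ a ∷ x)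
    fe-coeff : ∀ {k k' b x} → k ≈ k' → FreeEq _~_ ((k , b) ∷ x) ((k' , b) ∷ x)
    fe-basis : ∀ {k b b' x} → b ~ b' → FreeEq _~_ ((k , b) ∷ x) ((k , b') ∷ x)
    fe-merge : ∀ {k k' b x} → FreeEq _~_ ((k , b) ∷ (k' , b) ∷ x) ((k + k' , b) ∷ x)
    fe-zero  : ∀ {b x} → FreeEq _~_ ((0# , b) ∷ x) x

  -- H, H ⊗ H, H ⊗ H ⊗ H (the tensor powers of a free space are free on
  -- tuples of basis elements)
  H : Set c
  H = Formal TAG

  H2 : Set c
  H2 = Formal (TAG × TAG)

  H3 : Set c
  H3 = Formal (TAG × TAG × TAG)

  _≅³_ : TAG × TAG × TAG → TAG × TAG × TAG → Set
  (a , b , d) ≅³ (a' , b' , d') = (a ≅ a') × (b ≅ b') × (d ≅ d')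

  _≈H3_ : H3 → H3 → Set (c ⊔ ℓ)
  _≈H3_ = FreeEq _≅³_

  Δbasis : TAG → H2
  Δbasis Γ = map (λ p → (1# , p)) (subgraphPairs Γ)

  Δ : H → H2
  Δ = concatMap (λ t → map (λ s → (proj₁ t * proj₁ s , proj₂ s)) (Δbasis (proj₂ t)))

  Δ⊗Id : H2 → H3
  Δ⊗Id = concatMap (λ t →
    map (λ s → (proj₁ t * proj₁ s , proj₁ (proj₂ s) , proj₂ (proj₂ s) , proj₂ (proj₂ t)))
        (Δbasis (proj₁ (proj₂ t))))

  Id⊗Δ : H2 → H3
  Id⊗Δ = concatMap (λ t →
    map (λ s → (proj₁ t * proj₁ s , proj₁ (proj₂ t) , proj₁ (proj₂ s) , proj₂ (proj₂ s)))
        (Δbasis (proj₂ (proj₂ t))))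

-- Fix a TAG Γ with edge list es.  Both (Δ ⊗ Id)(ΔΓ) and (Id ⊗ Δ)(ΔΓ) are
-- sums indexed by the three-way splits (α , β , ρ) of es into ordered blocks:
-- the left side contributes  α ⊗ (α∪β)/α ⊗ Γ/(α∪β),  the right side
-- α ⊗ β/α ⊗ (Γ/α)/(β/α),  where β/α is β read as edges of Γ/α.

module Submission where

open import Defs
open import Level using (_⊔_)
open import Algebra.Bundles using (CommutativeRing)
open import Data.Nat using (ℕ)
open import Data.Fin using (Fin; _≟_)
open import Data.Product using (_×_; _,_; ∃; proj₁; proj₂)
open import Data.Sum using (_⊎_; inj₁; inj₂)
open import Data.Empty using (⊥-elim)
open import Function using (id)
open import Data.List using (List; []; _∷_; [_]; map; concatMap; foldl; _++_)
open import Data.List.Properties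
  using (++-assoc; ++-identityʳ; map-∘; concatMap-++; concatMap-map; map-concatMap; concatMap-pure; concatMap-cong)
open import Data.List.Effectful using (module MonadProperties)
open import Data.List.Relation.Unary.Any using (here; there)
open import Data.List.Relation.Unary.All using (All; []; _∷_; lookup)
open import Data.List.Membership.Propositional using (_∈_)
open import Data.List.Membership.Propositional.Properties using (∈-map⁺; ∈-map⁻)
open import Data.List.Relation.Binary.Pointwise using (Pointwise; []; _∷_)
open import Data.List.Relation.Binary.Permutation.Propositional as Perm
  using (_↭_; ↭-refl; ↭-sym; ↭-trans; module PermutationReasoning)
open import Data.List.Relation.Binary.Permutation.Propositional.Properties
  using (++⁺ˡ; ++⁺; shifts; map⁺)
open import Relation.Nullary using (yes; no)
open import Relation.Binary.Bundles using (Setoid)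
open import Relation.Binary.PropositionalEquality
  using (_≡_; refl; sym; trans; cong; cong₂; module ≡-Reasoning)
import Relation.Binary.Reasoning.Setoid as SetoidReasoning

Edge : ℕ → Set
Edge m = Fin m × Fin m

relabel : ∀ {m} → (Fin m → Fin m) → List (Edge m) → List (Edge m)
relabel f = map (λ e → f (proj₁ e) , f (proj₂ e))

-- the edges r, read as edges of Γ/γ; by definition  shrink γ r = tag m (contract γ r)
contract : ∀ {m} → List (Edge m) → List (Edge m) → List (Edge m)
contract γ = relabel (component γ)

-- 1. Connectivity and the labelling `component`

module _ {m : ℕ} where

  -- For c the identity it is "joined by a path in es"; the general c
  -- is the invariant of the left fold defining `component`.
  data Joined (c : Fin m → Fin m) (es : List (Edge m)) : Fin m → Fin m → Set where
    by-label : ∀ {x y} → c x ≡ c y → Joined c es x y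
    by-edge  : ∀ {x y} → (x , y) ∈ es → Joined c es x y
    invert   : ∀ {x y} → Joined c es x y → Joined c es y x
    compose  : ∀ {x y z} → Joined c es x y → Joined c es y z → Joined c es x z

  Connected : List (Edge m) → Fin m → Fin m → Set
  Connected = Joined id

  Joined-mono : ∀ {c es es'} → (∀ {e} → e ∈ es → e ∈ es') →
                ∀ {x y} → Joined c es x y → Joined c es' x y
  Joined-mono sub (by-label p)  = by-label p
  Joined-mono sub (by-edge e∈)  = by-edge (sub e∈)
  Joined-mono sub (invert p)    = invert (Joined-mono sub p)
  Joined-mono sub (compose p q) = compose (Joined-mono sub p) (Joined-mono sub q)

  merge-sound : ∀ (c : Fin m → Fin m) u v es x y → mergeEdge c (u , v) x ≡ mergeEdge c (u , v) y →
                Joined c ((u , v) ∷ es) x y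
  merge-sound c u v es x y eq with c x ≟ c v | c y ≟ c v
  ... | yes x~v | yes y~v = by-label (trans x~v (sym y~v))
  ... | yes x~v | no  _   = compose (by-label x~v) (compose (invert (by-edge (here refl))) (by-label eq))
  ... | no  _   | yes y~v = compose (by-label eq) (compose (by-edge (here refl)) (by-label (sym y~v)))
  ... | no  _   | no  _   = by-label eq

  merge-respects : ∀ (c : Fin m → Fin m) e x y → c x ≡ c y → mergeEdge c e x ≡ mergeEdge c e y
  merge-respects c (u , v) x y eq with c x ≟ c v | c y ≟ c v
  ... | yes _   | yes _   = refl
  ... | yes x~v | no  y≁v = ⊥-elim (y≁v (trans (sym eq) x~v))
  ... | no  x≁v | yes y~v = ⊥-elim (x≁v (trans eq y~v))
  ... | no  _   | no  _   = eq

  merge-joins : ∀ (c : Fin m → Fin m) u v → mergeEdge c (u , v) u ≡ mergeEdge c (u , v) v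
  merge-joins c u v with c u ≟ c v | c v ≟ c v
  ... | yes _ | yes _   = refl
  ... | no  _ | yes _   = refl
  ... | _     | no  v≁v = ⊥-elim (v≁v refl)

  -- Moving the first edge into the labelling does not change `Joined`.
  absorb : ∀ (c : Fin m → Fin m) u v es {x y} → Joined (mergeEdge c (u , v)) es x y → Joined c ((u , v) ∷ es) x y
  absorb c u v es (by-label p)  = merge-sound c u v es _ _ p
  absorb c u v es (by-edge e∈)  = by-edge (there e∈)
  absorb c u v es (invert p)    = invert (absorb c u v es p)
  absorb c u v es (compose p q) = compose (absorb c u v es p) (absorb c u v es q)

  emit : ∀ (c : Fin m → Fin m) u v es {x y} → Joined c ((u , v) ∷ es) x y → Joined (mergeEdge c (u , v)) es x y
  emit c u v es (by-label p)          = by-label (merge-respects c (u , v) _ _ p)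
  emit c u v es (by-edge (here refl)) = by-label (merge-joins c u v)
  emit c u v es (by-edge (there e∈))  = by-edge e∈
  emit c u v es (invert p)            = invert (emit c u v es p)
  emit c u v es (compose p q)         = compose (emit c u v es p) (emit c u v es q)

  Joined-[] : ∀ (c : Fin m → Fin m) {x y} → Joined c [] x y → c x ≡ c y
  Joined-[] c (by-label p)  = p
  Joined-[] c (by-edge ())
  Joined-[] c (invert p)    = sym (Joined-[] c p)
  Joined-[] c (compose p q) = trans (Joined-[] c p) (Joined-[] c q)

  -- Invariant of the fold: after the edges es, equal labels = Joined c es.
  fold-sound : ∀ (c : Fin m → Fin m) es x y → foldl mergeEdge c es x ≡ foldl mergeEdge c es y → Joined c es x y
  fold-sound c []             x y eq = by-label eq
  fold-sound c ((u , v) ∷ es) x y eq = absorb c u v es (fold-sound (mergeEdge c (u , v)) es x y eq)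

  fold-complete : ∀ (c : Fin m → Fin m) es {x y} → Joined c es x y → foldl mergeEdge c es x ≡ foldl mergeEdge c es y
  fold-complete c []             p = Joined-[] c p
  fold-complete c ((u , v) ∷ es) p = fold-complete (mergeEdge c (u , v)) es (emit c u v es p)

  component-sound : ∀ γ x y → component γ x ≡ component γ y → Connected γ x y
  component-sound = fold-sound id

  component-complete : ∀ γ {x y} → Connected γ x y → component γ x ≡ component γ y
  component-complete = fold-complete id

  merge-idempotent : ∀ (c : Fin m → Fin m) e → (∀ w → c (c w) ≡ c w) →
                     ∀ w → mergeEdge c e (mergeEdge c e w) ≡ mergeEdge c e w
  merge-idempotent c (u , v) idem w with c w ≟ c v
  ... | yes _ with c (c u) ≟ c v
  ...   | yes _ = refl
  ...   | no  _ = idem u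
  merge-idempotent c (u , v) idem w | no w≁v with c (c w) ≟ c v
  ...   | yes cw~v = ⊥-elim (w≁v (trans (sym (idem w)) cw~v))
  ...   | no  _    = idem w

  fold-idempotent : ∀ (c : Fin m → Fin m) es → (∀ w → c (c w) ≡ c w) →
                    ∀ w → foldl mergeEdge c es (foldl mergeEdge c es w) ≡ foldl mergeEdge c es w
  fold-idempotent c []       idem = idem
  fold-idempotent c (e ∷ es) idem = fold-idempotent (mergeEdge c e) es (merge-idempotent c e idem)

  connected-to-label : ∀ γ w → Connected γ w (component γ w)
  connected-to-label γ w =
    component-sound γ w (component γ w) (sym (fold-idempotent id γ (λ _ → refl) w))

  incident-image : ∀ (f : Fin m → Fin m) r u → Incident (relabel f r) u → ∃ λ x → u ≡ f x
  incident-image f (e ∷ r) u (here (inj₁ u≡)) = proj₁ e , u≡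
  incident-image f (e ∷ r) u (here (inj₂ u≡)) = proj₂ e , u≡
  incident-image f (e ∷ r) u (there i)        = incident-image f r u i

-- 2. Binary splits of a list

module _ {A : Set} where

  data IsSplit : List A → List A × List A → Set where
    []    : IsSplit [] ([] , [])
    left  : ∀ {x xs ys zs} → IsSplit xs (ys , zs) → IsSplit (x ∷ xs) (x ∷ ys , zs)
    right : ∀ {x xs ys zs} → IsSplit xs (ys , zs) → IsSplit (x ∷ xs) (ys , x ∷ zs)

  addToSplit : A → List A × List A → List (List A × List A)
  addToSplit x (ys , zs) = (x ∷ ys , zs) ∷ (ys , x ∷ zs) ∷ []

  splits-sound : ∀ xs → All (IsSplit xs) (splits xs)
  splits-sound []       = [] ∷ []
  splits-sound (x ∷ xs) = extend (splits xs) (splits-sound xs)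
    where
    extend : ∀ ps → All (IsSplit xs) ps → All (IsSplit (x ∷ xs)) (concatMap (addToSplit x) ps)
    extend []       []       = []
    extend (_ ∷ ps) (s ∷ ss) = left s ∷ right s ∷ extend ps ss

  split-∈ : ∀ {xs ys zs e} → IsSplit xs (ys , zs) → e ∈ xs → e ∈ ys ⊎ e ∈ zs
  split-∈ (left  s) (here e≡) = inj₁ (here e≡)
  split-∈ (right s) (here e≡) = inj₂ (here e≡)
  split-∈ (left  s) (there e∈) with split-∈ s e∈
  ... | inj₁ e∈ys = inj₁ (there e∈ys)
  ... | inj₂ e∈zs = inj₂ e∈zs
  split-∈ (right s) (there e∈) with split-∈ s e∈
  ... | inj₁ e∈ys = inj₁ e∈ys
  ... | inj₂ e∈zs = inj₂ (there e∈zs)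

  chosen-⊆ : ∀ {xs ys zs e} → IsSplit xs (ys , zs) → e ∈ ys → e ∈ xs
  chosen-⊆ (left  s) (here e≡)  = here e≡
  chosen-⊆ (left  s) (there e∈) = there (chosen-⊆ s e∈)
  chosen-⊆ (right s) e∈         = there (chosen-⊆ s e∈)

  rest-⊆ : ∀ {xs ys zs e} → IsSplit xs (ys , zs) → e ∈ zs → e ∈ xs
  rest-⊆ (left  s) e∈         = there (rest-⊆ s e∈)
  rest-⊆ (right s) (here e≡)  = here e≡
  rest-⊆ (right s) (there e∈) = there (rest-⊆ s e∈)

splits-map : ∀ {A : Set} (f : A → A) xs →
             splits (map f xs) ≡ map (λ q → map f (proj₁ q) , map f (proj₂ q)) (splits xs)
splits-map f []       = refl
splits-map {A} f (x ∷ xs) = begin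
  concatMap (addToSplit (f x)) (splits (map f xs))
    ≡⟨ cong (concatMap (addToSplit (f x))) (splits-map f xs) ⟩
  concatMap (addToSplit (f x)) (map mapBoth (splits xs))
    ≡⟨ concatMap-map (addToSplit (f x)) mapBoth (splits xs) ⟩
  concatMap (λ q → map mapBoth (addToSplit x q)) (splits xs)
    ≡⟨ map-concatMap mapBoth (addToSplit x) (splits xs) ⟨
  map mapBoth (concatMap (addToSplit x) (splits xs)) ∎
  where
  open ≡-Reasoning
  mapBoth : List A × List A → List A × List A
  mapBoth q = map f (proj₁ q) , map f (proj₂ q)

-- 3. Shrinking in stages:  Γ/γ ≅ (Γ/δ)/(γ/δ)  for  γ = δ ∪ a

module _ {m : ℕ} {γ δ a : List (Edge m)} (split : IsSplit γ (δ , a)) where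

  to-δ-label : ∀ z → Connected γ z (component δ z)
  to-δ-label z = Joined-mono (chosen-⊆ split) (connected-to-label δ z)

  -- a path of γ becomes a path of γ/δ: edges of δ collapse, edges of a survive
  to-quotient : ∀ {x y} → Connected γ x y → Connected (contract δ a) (component δ x) (component δ y)
  to-quotient (by-label refl) = by-label refl
  to-quotient (by-edge e∈γ) with split-∈ split e∈γ
  ... | inj₁ e∈δ = by-label (component-complete δ (by-edge e∈δ))
  ... | inj₂ e∈a = by-edge (∈-map⁺ _ e∈a)
  to-quotient (invert p)    = invert (to-quotient p)
  to-quotient (compose p q) = compose (to-quotient p) (to-quotient q)

  -- an edge of γ/δ comes from an edge of a, whose endpoints are joined in γ
  -- to their δ-labels
  from-quotient : ∀ {x y} → Connected (contract δ a) x y → Connected γ x y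
  from-quotient (by-label refl) = by-label refl
  from-quotient (by-edge e∈) with ∈-map⁻ _ e∈
  ... | (u , v) , uv∈a , refl =
    compose (invert (to-δ-label u)) (compose (by-edge (rest-⊆ split uv∈a)) (to-δ-label v))
  from-quotient (invert p)    = invert (from-quotient p)
  from-quotient (compose p q) = compose (from-quotient p) (from-quotient q)

  -- the vertex map Γ/γ → (Γ/δ)/(γ/δ)
  twoStep : Fin m → Fin m
  twoStep w = component (contract δ a) (component δ w)

  twoStep-sound : ∀ x y → component γ x ≡ component γ y → twoStep x ≡ twoStep y
  twoStep-sound x y eq = component-complete (contract δ a) (to-quotient (component-sound γ x y eq))

  twoStep-complete : ∀ x y → twoStep x ≡ twoStep y → component γ x ≡ component γ y
  twoStep-complete x y eq = component-complete γ
    (compose (to-δ-label x)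
      (compose (from-quotient (component-sound (contract δ a) _ _ eq)) (invert (to-δ-label y))))

  twoStep-label : ∀ x → twoStep (component γ x) ≡ twoStep x
  twoStep-label x = twoStep-sound (component γ x) x (component-complete γ (invert (connected-to-label γ x)))

  shrink-in-stages : ∀ r → shrink γ r ≅ shrink (contract δ a) (contract δ r)
  shrink-in-stages r = twoStep , mapsEdges r , injective
    where
    mapsEdges : ∀ r → Pointwise (MapsEdge twoStep) (contract γ r) (contract (contract δ a) (contract δ r))
    mapsEdges []      = []
    mapsEdges (e ∷ r) = inj₁ (twoStep-label (proj₁ e) , twoStep-label (proj₂ e)) ∷ mapsEdges r

    injective : ∀ u v → Incident (contract γ r) u → Incident (contract γ r) v → twoStep u ≡ twoStep v → u ≡ v
    injective u v iu iv eq with incident-image (component γ) r u iu | incident-image (component γ) r v iv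
    ... | x , refl | y , refl = twoStep-complete x y (trans (sym (twoStep-label x)) (trans eq (twoStep-label y)))

-- 4. Two enumerations of the three-way splits

module _ {A B : Set} where

  concatMap⁺ : ∀ (f : A → List B) {xs ys} → xs ↭ ys → concatMap f xs ↭ concatMap f ys
  concatMap⁺ f Perm.refl          = ↭-refl
  concatMap⁺ f (Perm.prep x p)    = ++⁺ˡ (f x) (concatMap⁺ f p)
  concatMap⁺ f (Perm.swap x y p)  = ↭-trans (++⁺ˡ (f x) (++⁺ˡ (f y) (concatMap⁺ f p))) (shifts (f x) (f y))
  concatMap⁺ f (Perm.trans p q)   = ↭-trans (concatMap⁺ f p) (concatMap⁺ f q)

  concatMap-cong-↭ : ∀ {f g : A → List B} → (∀ x → f x ↭ g x) → ∀ xs → concatMap f xs ↭ concatMap g xs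
  concatMap-cong-↭ f↭g []       = ↭-refl
  concatMap-cong-↭ f↭g (x ∷ xs) = ++⁺ (f↭g x) (concatMap-cong-↭ f↭g xs)

  concatMap-++-↭ : ∀ (f g : A → List B) xs →
                   concatMap f xs ++ concatMap g xs ↭ concatMap (λ x → f x ++ g x) xs
  concatMap-++-↭ f g []       = ↭-refl
  concatMap-++-↭ f g (x ∷ xs) = begin
    (f x ++ F) ++ (g x ++ G)  ≡⟨ ++-assoc (f x) F (g x ++ G) ⟩
    f x ++ (F ++ (g x ++ G))  ↭⟨ ++⁺ˡ (f x) (shifts F (g x)) ⟩
    f x ++ (g x ++ (F ++ G))  ≡⟨ ++-assoc (f x) (g x) (F ++ G) ⟨
    (f x ++ g x) ++ (F ++ G)  ↭⟨ ++⁺ˡ (f x ++ g x) (concatMap-++-↭ f g xs) ⟩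
    (f x ++ g x) ++ concatMap (λ x → f x ++ g x) xs ∎
    where
    open PermutationReasoning
    F = concatMap f xs
    G = concatMap g xs

  map-as-concatMap : ∀ (h : A → B) xs → map h xs ≡ concatMap (λ x → [ h x ]) xs
  map-as-concatMap h xs = trans (sym (concatMap-pure (map h xs))) (concatMap-map [_] h xs)

module _ {A : Set} where

  Split₃ : Set
  Split₃ = List A × List A × List A

  splitChosen : List A → List Split₃
  splitChosen xs = concatMap (λ p → map (λ q → proj₁ q , proj₂ q , proj₂ p) (splits (proj₁ p))) (splits xs)

  splitRest : List A → List Split₃
  splitRest xs = concatMap (λ p → map (λ q → proj₁ p , proj₁ q , proj₂ q) (splits (proj₂ p))) (splits xs)

  place : A → Split₃ → List Split₃
  place x (α , β , ρ) = (x ∷ α , β , ρ) ∷ (α , x ∷ β , ρ) ∷ (α , β , x ∷ ρ) ∷ []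

  splits₃ : List A → List Split₃
  splits₃ []       = ([] , [] , []) ∷ []
  splits₃ (x ∷ xs) = concatMap (place x) (splits₃ xs)

  private
    bind-assoc : ∀ (f : List A × List A → List Split₃) x xs →
                 concatMap f (concatMap (addToSplit x) (splits xs)) ≡
                 concatMap (λ p → concatMap f (addToSplit x p)) (splits xs)
    bind-assoc f x xs = sym (MonadProperties.associative (splits xs) (addToSplit x) f)

  -- adding an entry x to the front: both enumerations place x in every block
  splitChosen-∷ : ∀ x xs → splitChosen (x ∷ xs) ↭ concatMap (place x) (splitChosen xs)
  splitChosen-∷ x xs = begin
    splitChosen (x ∷ xs)
      ≡⟨ bind-assoc chosenTriples x xs ⟩
    concatMap (λ p → concatMap chosenTriples (addToSplit x p)) (splits xs)
      ↭⟨ concatMap-cong-↭ step (splits xs) ⟩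
    concatMap (λ p → concatMap (place x) (chosenTriples p)) (splits xs)
      ≡⟨ MonadProperties.associative (splits xs) chosenTriples (place x) ⟩
    concatMap (place x) (splitChosen xs) ∎
    where
    open PermutationReasoning
    chosenTriples : List A × List A → List Split₃
    chosenTriples p = map (λ q → proj₁ q , proj₂ q , proj₂ p) (splits (proj₁ p))

    step : ∀ p → concatMap chosenTriples (addToSplit x p) ↭ concatMap (place x) (chosenTriples p)
    step (γ , ρ) = begin
      chosenTriples (x ∷ γ , ρ) ++ (chosenTriples (γ , x ∷ ρ) ++ [])
        ≡⟨ cong₂ _++_ (map-concatMap _ (addToSplit x) (splits γ))
                      (trans (++-identityʳ _) (map-as-concatMap _ (splits γ))) ⟩
      concatMap (λ q → (x ∷ proj₁ q , proj₂ q , ρ) ∷ (proj₁ q , x ∷ proj₂ q , ρ) ∷ []) (splits γ)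
        ++ concatMap (λ q → [ proj₁ q , proj₂ q , x ∷ ρ ]) (splits γ)
        ↭⟨ concatMap-++-↭ _ _ (splits γ) ⟩
      concatMap (λ q → place x (proj₁ q , proj₂ q , ρ)) (splits γ)
        ≡⟨ concatMap-map (place x) _ (splits γ) ⟨
      concatMap (place x) (chosenTriples (γ , ρ)) ∎

  splitRest-∷ : ∀ x xs → splitRest (x ∷ xs) ↭ concatMap (place x) (splitRest xs)
  splitRest-∷ x xs = begin
    splitRest (x ∷ xs)
      ≡⟨ bind-assoc restTriples x xs ⟩
    concatMap (λ p → concatMap restTriples (addToSplit x p)) (splits xs)
      ↭⟨ concatMap-cong-↭ step (splits xs) ⟩
    concatMap (λ p → concatMap (place x) (restTriples p)) (splits xs)
      ≡⟨ MonadProperties.associative (splits xs) restTriples (place x) ⟩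
    concatMap (place x) (splitRest xs) ∎
    where
    open PermutationReasoning
    restTriples : List A × List A → List Split₃
    restTriples p = map (λ q → proj₁ p , proj₁ q , proj₂ q) (splits (proj₂ p))

    step : ∀ p → concatMap restTriples (addToSplit x p) ↭ concatMap (place x) (restTriples p)
    step (α , σ) = begin
      restTriples (x ∷ α , σ) ++ (restTriples (α , x ∷ σ) ++ [])
        ≡⟨ cong₂ _++_ (map-as-concatMap _ (splits σ))
                      (trans (++-identityʳ _) (map-concatMap _ (addToSplit x) (splits σ))) ⟩
      concatMap (λ q → [ x ∷ α , proj₁ q , proj₂ q ]) (splits σ)
        ++ concatMap (λ q → (α , x ∷ proj₁ q , proj₂ q) ∷ (α , proj₁ q , x ∷ proj₂ q) ∷ []) (splits σ)
        ↭⟨ concatMap-++-↭ _ _ (splits σ) ⟩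
      concatMap (λ q → place x (α , proj₁ q , proj₂ q)) (splits σ)
        ≡⟨ concatMap-map (place x) _ (splits σ) ⟨
      concatMap (place x) (restTriples (α , σ)) ∎

  splitChosen↭splits₃ : ∀ xs → splitChosen xs ↭ splits₃ xs
  splitChosen↭splits₃ []       = ↭-refl
  splitChosen↭splits₃ (x ∷ xs) = ↭-trans (splitChosen-∷ x xs) (concatMap⁺ (place x) (splitChosen↭splits₃ xs))

  splitRest↭splits₃ : ∀ xs → splitRest xs ↭ splits₃ xs
  splitRest↭splits₃ []       = ↭-refl
  splitRest↭splits₃ (x ∷ xs) = ↭-trans (splitRest-∷ x xs) (concatMap⁺ (place x) (splitRest↭splits₃ xs))

  splitChosen↭splitRest : ∀ xs → splitChosen xs ↭ splitRest xs
  splitChosen↭splitRest xs = ↭-trans (splitChosen↭splits₃ xs) (↭-sym (splitRest↭splits₃ xs))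

-- 5. Linearity and coassociativity

≅-refl : ∀ Γ → Γ ≅ Γ
≅-refl (tag m es) = id , identity es , λ u v _ _ eq → eq
  where
  identity : ∀ es → Pointwise (MapsEdge id) es es
  identity []       = []
  identity (e ∷ es) = inj₁ (refl , refl) ∷ identity es

module Coassociativity {c ℓ} (K : CommutativeRing c ℓ) where
  open Hopf K
  open CommutativeRing K using (Carrier; _*_; 1#)

  module _ {B : Set} {_~_ : B → B → Set} where

    FreeEq-setoid : Setoid c (c ⊔ ℓ)
    FreeEq-setoid = record
      { Carrier       = Formal B
      ; _≈_           = FreeEq _~_
      ; isEquivalence = record { refl = fe-refl ; sym = fe-sym ; trans = fe-trans }
      }

    ≡⇒FreeEq : ∀ {x y} → x ≡ y → FreeEq _~_ x y
    ≡⇒FreeEq refl = fe-refl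

    FreeEq-++ˡ : ∀ {x y} z → FreeEq _~_ x y → FreeEq _~_ (x ++ z) (y ++ z)
    FreeEq-++ˡ z fe-refl         = fe-refl
    FreeEq-++ˡ z (fe-sym p)      = fe-sym (FreeEq-++ˡ z p)
    FreeEq-++ˡ z (fe-trans p q)  = fe-trans (FreeEq-++ˡ z p) (FreeEq-++ˡ z q)
    FreeEq-++ˡ z (fe-cons p)     = fe-cons (FreeEq-++ˡ z p)
    FreeEq-++ˡ z fe-swap         = fe-swap
    FreeEq-++ˡ z (fe-coeff k≈k') = fe-coeff k≈k'
    FreeEq-++ˡ z (fe-basis b~b') = fe-basis b~b'
    FreeEq-++ˡ z fe-merge        = fe-merge
    FreeEq-++ˡ z fe-zero         = fe-zero

    FreeEq-++ʳ : ∀ x {y z} → FreeEq _~_ y z → FreeEq _~_ (x ++ y) (x ++ z)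
    FreeEq-++ʳ []      p = p
    FreeEq-++ʳ (_ ∷ x) p = fe-cons (FreeEq-++ʳ x p)

    FreeEq-++ : ∀ {x x' y y'} → FreeEq _~_ x x' → FreeEq _~_ y y' → FreeEq _~_ (x ++ y) (x' ++ y')
    FreeEq-++ {x' = x'} {y = y} p q = fe-trans (FreeEq-++ˡ y p) (FreeEq-++ʳ x' q)

    ↭⇒FreeEq : ∀ {x y} → x ↭ y → FreeEq _~_ x y
    ↭⇒FreeEq Perm.refl         = fe-refl
    ↭⇒FreeEq (Perm.prep _ p)   = fe-cons (↭⇒FreeEq p)
    ↭⇒FreeEq (Perm.swap _ _ p) = fe-trans fe-swap (fe-cons (fe-cons (↭⇒FreeEq p)))
    ↭⇒FreeEq (Perm.trans p q)  = fe-trans (↭⇒FreeEq p) (↭⇒FreeEq q)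

    FreeEq-concatMap : ∀ {A : Set} {f g : A → Formal B} → (∀ x → FreeEq _~_ (f x) (g x)) →
                       ∀ xs → FreeEq _~_ (concatMap f xs) (concatMap g xs)
    FreeEq-concatMap f≈g []       = fe-refl
    FreeEq-concatMap f≈g (x ∷ xs) = FreeEq-++ (f≈g x) (FreeEq-concatMap f≈g xs)

    FreeEq-basis : ∀ {A : Set} (k : Carrier) (f g : A → B) xs → (∀ {x} → x ∈ xs → f x ~ g x) →
                   FreeEq _~_ (map (λ x → k , f x) xs) (map (λ x → k , g x) xs)
    FreeEq-basis k f g []       f~g = fe-refl
    FreeEq-basis k f g (x ∷ xs) f~g =
      fe-trans (fe-basis (f~g (here refl))) (fe-cons (FreeEq-basis k f g xs (λ x∈ → f~g (there x∈))))

  module OnBasis (k : Carrier) (m : ℕ) where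

    -- Δ ((k , tag m es) ∷ v)  reduces to  Δterm (splits es) ++ Δ v
    Δterm : List (List (Edge m) × List (Edge m)) → H2
    Δterm P = map (λ s → k * proj₁ s , proj₂ s)
                (map (λ p → 1# , p) (map (λ p → tag m (proj₁ p) , shrink (proj₁ p) (proj₂ p)) P))

    κ : Carrier
    κ = (k * 1#) * 1#

    -- the common form of both sides: the term indexed by a three-way split
    -- (α , β , ρ) is  α ⊗ β/α ⊗ (Γ/α)/(β/α)
    term₃ : Split₃ → Carrier × (TAG × TAG × TAG)
    term₃ (α , β , ρ) = κ , tag m α , shrink α β , shrink (contract α β) (contract α ρ)

    Δ⊗Id-Δterm : ∀ P → Δ⊗Id (Δterm P) ≡
      concatMap (λ p → map (λ q → κ , tag m (proj₁ q) , shrink (proj₁ q) (proj₂ q) , shrink (proj₁ p) (proj₂ p))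
                           (splits (proj₁ p))) P
    Δ⊗Id-Δterm []      = refl
    Δ⊗Id-Δterm (p ∷ P) = cong₂ _++_ (trans (sym (map-∘ _)) (sym (map-∘ _))) (Δ⊗Id-Δterm P)

    Id⊗Δ-Δterm : ∀ P → Id⊗Δ (Δterm P) ≡
      concatMap (λ p → map (λ q → κ , tag m (proj₁ p) , tag m (proj₁ q) , shrink (proj₁ q) (proj₂ q))
                           (splits (contract (proj₁ p) (proj₂ p)))) P
    Id⊗Δ-Δterm []      = refl
    Id⊗Δ-Δterm (p ∷ P) = cong₂ _++_ (trans (sym (map-∘ _)) (sym (map-∘ _))) (Id⊗Δ-Δterm P)

    -- On the left the term for γ ⊆ δ ⊆ Γ is isomorphic to term₃ (γ , δ∖γ , Γ∖δ),
    -- because Γ/δ ≅ (Γ/γ)/(δ/γ).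
    left-side : ∀ es → Δ⊗Id (Δterm (splits es)) ≈H3 map term₃ (splitChosen es)
    left-side es = begin
      Δ⊗Id (Δterm (splits es))
        ≡⟨ Δ⊗Id-Δterm (splits es) ⟩
      concatMap (λ p → map (λ q → κ , lhs p q) (splits (proj₁ p))) (splits es)
        ≈⟨ FreeEq-concatMap (λ p → FreeEq-basis κ (lhs p) (rhs p) (splits (proj₁ p))
                                     (λ q∈ → stages p (lookup (splits-sound (proj₁ p)) q∈)))
                            (splits es) ⟩
      concatMap (λ p → map (λ q → term₃ (proj₁ q , proj₂ q , proj₂ p)) (splits (proj₁ p))) (splits es)
        ≡⟨ concatMap-cong (λ p → map-∘ (splits (proj₁ p))) (splits es) ⟩
      concatMap (λ p → map term₃ (map (λ q → proj₁ q , proj₂ q , proj₂ p) (splits (proj₁ p)))) (splits es)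
        ≡⟨ map-concatMap term₃ _ (splits es) ⟨
      map term₃ (splitChosen es) ∎
      where
      open SetoidReasoning (FreeEq-setoid {_~_ = _≅³_})
      lhs rhs : List (Edge m) × List (Edge m) → List (Edge m) × List (Edge m) → TAG × TAG × TAG
      lhs p q = tag m (proj₁ q) , shrink (proj₁ q) (proj₂ q) , shrink (proj₁ p) (proj₂ p)
      rhs p q = proj₂ (term₃ (proj₁ q , proj₂ q , proj₂ p))

      stages : ∀ p {q} → IsSplit (proj₁ p) q → lhs p q ≅³ rhs p q
      stages (δ , ρ) {α , β} s = ≅-refl (tag m α) , ≅-refl (shrink α β) , shrink-in-stages s ρ

    -- On the right the term is literally term₃ (δ , σ , ρ∖σ), since the splits
    -- of the edges of Γ/δ are the contracted splits of the rest ρ.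
    right-side : ∀ es → Id⊗Δ (Δterm (splits es)) ≈H3 map term₃ (splitRest es)
    right-side es = ≡⇒FreeEq (begin
      Id⊗Δ (Δterm (splits es))
        ≡⟨ Id⊗Δ-Δterm (splits es) ⟩
      concatMap (λ p → map (λ q → κ , tag m (proj₁ p) , tag m (proj₁ q) , shrink (proj₁ q) (proj₂ q))
                           (splits (contract (proj₁ p) (proj₂ p)))) (splits es)
        ≡⟨ concatMap-cong
             (λ p → trans (cong (map _) (splits-map _ (proj₂ p))) (sym (map-∘ (splits (proj₂ p)))))
             (splits es) ⟩
      concatMap (λ p → map (λ q → term₃ (proj₁ p , proj₁ q , proj₂ q)) (splits (proj₂ p))) (splits es)
        ≡⟨ concatMap-cong (λ p → map-∘ (splits (proj₂ p))) (splits es) ⟩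
      concatMap (λ p → map term₃ (map (λ q → proj₁ p , proj₁ q , proj₂ q) (splits (proj₂ p)))) (splits es)
        ≡⟨ map-concatMap term₃ _ (splits es) ⟨
      map term₃ (splitRest es) ∎)
      where open ≡-Reasoning

    on-basis : ∀ es → Δ⊗Id (Δterm (splits es)) ≈H3 Id⊗Δ (Δterm (splits es))
    on-basis es = begin
      Δ⊗Id (Δterm (splits es))  ≈⟨ left-side es ⟩
      map term₃ (splitChosen es) ≈⟨ ↭⇒FreeEq (map⁺ term₃ (splitChosen↭splitRest es)) ⟩
      map term₃ (splitRest es)   ≈⟨ right-side es ⟨
      Id⊗Δ (Δterm (splits es))  ∎
      where open SetoidReasoning (FreeEq-setoid {_~_ = _≅³_})

  -- Δ⊗Id and Id⊗Δ are additive, so coassociativity follows term by term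
  coassociative : (v : H) → Δ⊗Id (Δ v) ≈H3 Id⊗Δ (Δ v)
  coassociative []                    = fe-refl
  coassociative ((k , tag m es) ∷ v) = begin
    Δ⊗Id (Δterm (splits es) ++ Δ v)             ≡⟨ concatMap-++ _ (Δterm (splits es)) (Δ v) ⟩
    Δ⊗Id (Δterm (splits es)) ++ Δ⊗Id (Δ v)      ≈⟨ FreeEq-++ (on-basis es) (coassociative v) ⟩
    Id⊗Δ (Δterm (splits es)) ++ Id⊗Δ (Δ v)      ≡⟨ concatMap-++ _ (Δterm (splits es)) (Δ v) ⟨
    Id⊗Δ (Δterm (splits es) ++ Δ v)             ∎
    where
    open OnBasis k m
    open SetoidReasoning (FreeEq-setoid {_~_ = _≅³_})

mainTheorem3 : ∀ {c ℓ} (K : CommutativeRing c ℓ) →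
    FieldDefs.IsField K → FieldDefs.CharZero K →
    (v : Hopf.H K) →
    Hopf._≈H3_ K (Hopf.Δ⊗Id K (Hopf.Δ K v)) (Hopf.Id⊗Δ K (Hopf.Δ K v))
mainTheorem3 K _ _ v = Coassociativity.coassociative K v
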